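{- Let $G=(V,E)$ be a graph, let $(A,B,D,M)$ be a nice decomposition of $G$, and let $H=H(G,A,B,D,M)$. Let $X$ be a dominant vertex cover of $G$ and let $X_{\mathrm{op}}=X_{\mathrm{op}}(A_1,A_3,M,X)$. Then $X_{\mathrm{op}}$ is closest to $A_3$ in $H$.
   Context: Graphs are finite and simple; $N(D)$ is the set of vertices outside $D$ with a neighbor in $D$; for a matching $M$ and covered vertex $v$, $M(v)$ is the vertex matched to $v$. A graph is factor-critical if deleting any single vertex leaves a graph with a perfect matching. A relaxed Gallai-Edmonds decomposition of $G=(V,E)$ is a tuple $(A,B,D,M)$ with $V=A\,\dot\cup\, B\,\dot\cup\, D$ and $M$ a maximum matching of $G$ such that: (1) $A=N(D)$; (2) each component of $G[D]$ is factor-critical; (3) $M$ restricted to $B$ is a perfect matching of $G[B]$; (4) $M$ restricted to any component $C$ of $G[D]$ is a near-perfect matching of $G[C]$; (5) each vertex of $A$ is matched by $M$ to a vertex of $D$. A component of $G[D]$ is matched if some $M$-edge joins it to $A$, unmatched otherwise; the decomposition is nice if there is no unmatched single-vertex component. $A_1$, $A_3$: vertices of $A$ matched by $M$ to single-vertex resp. multi-vertex components of $G[D]$. For $X\subseteq V$, $X_{\mathrm{op}}(A_1,A_3,M,X)$ is the set of $v\in A$ with either $v\in A_1$ and $v,M(v)\in X$, or $v\in A_3$ and $v\in X$. $H(G,A,B,D,M)$ is the directed graph on vertex set $A$ with an arc $(u,v)$ whenever there is $w\in D$ with $\{u,w\}\in E\setminus M$ and $\{w,v\}\in M$. A vertex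 cover $X$ of $G$ is dominant if $G$ has no vertex cover of size less than $|X|$ and no vertex cover of size $|X|$ contains fewer vertices of $D$. In a directed graph $H$ with $S,T\subseteq V(H)$, a set $Y$ is an $S,T$-separator if $H-Y$ has no path from $S\setminus Y$ to $T\setminus Y$ (so $S\cap T\subseteq Y$); $T$ is closest to $S$ if there is no $S,T$-separator $Y$ with $Y\neq T$ and $|Y|\le|T|$. -}

module Defs where

open import Data.Nat using (ℕ; _≤_; _<?_)
open import Data.Fin using (Fin; toℕ)
open import Data.Fin.Subset using (Subset; _∈_; _∉_; ∣_∣; _∩_)
open import Data.Vec using (tabulate)
open import Data.Bool using (Bool; true; false)
open import Data.Maybe using (Maybe; just; nothing)
open import Data.Product using (Σ; ∃; ∃-syntax; _×_; _,_)
open import Data.Sum using (_⊎_)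
open import Relation.Nullary using (¬_; Dec)
open import Relation.Nullary.Decidable using (⌊_⌋)
open import Relation.Binary.PropositionalEquality using (_≡_; _≢_)

record Graph (n : ℕ) : Set₁ where
  field
    Adj     : Fin n → Fin n → Set
    sym     : ∀ {u v} → Adj u v → Adj v u
    irrefl  : ∀ {u} → ¬ Adj u u
    adj?    : ∀ u v → Dec (Adj u v)
open Graph public

-- Matchings: M(v) = mate v  (nothing = v not covered)

record Matching {n : ℕ} (G : Graph n) : Set where
  field
    mate     : Fin n → Maybe (Fin n)
    mate-sym : ∀ {u v} → mate u ≡ just v → mate v ≡ just u
    mate-adj : ∀ {u v} → mate u ≡ just v → Adj G u v
open Matching public

lowEnd : ∀ {n} → Maybe (Fin n) → Fin n → Bool
lowEnd nothing  u = false
lowEnd (just v) u = ⌊ toℕ u <? toℕ v ⌋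

size : ∀ {n} {G : Graph n} → Matching G → ℕ
size M = ∣ tabulate (λ u → lowEnd (mate M u) u) ∣

Maximum : ∀ {n} {G : Graph n} → Matching G → Set
Maximum {G = G} M = ∀ (M' : Matching G) → size M' ≤ size M

data Side : Set where
  sA sB sD : Side

isD : Side → Bool
isD sD = true
isD sA = false
isD sB = false

module _ {n : ℕ} (G : Graph n) (side : Fin n → Side) where

  DSet : Subset n
  DSet = tabulate (λ v → isD (side v))

  data ConnD : Fin n → Fin n → Set where
    here : ∀ {u} → side u ≡ sD → ConnD u u
    step : ∀ {u w v} → side u ≡ sD → Adj G u w → ConnD w v → ConnD u v

  Singleton : Fin n → Set
  Singleton u = side u ≡ sD × (∀ w → ConnD u w → w ≡ u)

  MultiVertex : Fin n → Set
  MultiVertex u = side u ≡ sD × ∃[ w ] (ConnD u w × w ≢ u)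

  FactorCriticalComp : Fin n → Set
  FactorCriticalComp u =
    ∀ x → ConnD u x →
      Σ (Matching G) λ M' →
        (∀ y z → mate M' y ≡ just z → ConnD u y × ConnD u z × y ≢ x × z ≢ x)
        × (∀ y → ConnD u y → y ≢ x → ∃[ z ] (mate M' y ≡ just z))

  module _ (M : Matching G) where

    NearPerfectComp : Fin n → Set
    NearPerfectComp u =
      ∃[ x ] ( ConnD u x
             × ¬ (∃[ z ] (mate M x ≡ just z × ConnD u z))
             × (∀ y → ConnD u y → y ≢ x → ∃[ z ] (mate M y ≡ just z × ConnD u z)))

    record IsRelaxedGED : Set where
      field
        maximum  : Maximum M
        A⇒ND     : ∀ v → side v ≡ sA → ∃[ w ] (side w ≡ sD × Adj G v w)
        ND⇒A     : ∀ v w → side v ≢ sD → side w ≡ sD → Adj G v w → side v ≡ sA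
        factCrit : ∀ u → side u ≡ sD → FactorCriticalComp u
        perfB    : ∀ v → side v ≡ sB → ∃[ w ] (mate M v ≡ just w × side w ≡ sB)
        nearPerf : ∀ u → side u ≡ sD → NearPerfectComp u
        matchA   : ∀ v → side v ≡ sA → ∃[ w ] (mate M v ≡ just w × side w ≡ sD)

    MatchedComp : Fin n → Set
    MatchedComp u = ∃[ x ] (ConnD u x × ∃[ a ] (side a ≡ sA × mate M x ≡ just a))

    Nice : Set
    Nice = ∀ u → Singleton u → MatchedComp u

    A₁ : Fin n → Set
    A₁ v = side v ≡ sA × ∃[ w ] (mate M v ≡ just w × Singleton w)

    A₃ : Fin n → Set
    A₃ v = side v ≡ sA × ∃[ w ] (mate M v ≡ just w × MultiVertex w)

    InXop : Subset n → Fin n → Set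
    InXop X v = (A₁ v × v ∈ X × ∃[ w ] (mate M v ≡ just w × w ∈ X))
              ⊎ (A₃ v × v ∈ X)

    Arc : Fin n → Fin n → Set
    Arc u v = side u ≡ sA × side v ≡ sA
            × ∃[ w ] (side w ≡ sD × Adj G u w × mate M u ≢ just w × mate M w ≡ just v)

    data PathAvoid (Y : Subset n) : Fin n → Fin n → Set where
      here : ∀ {u} → side u ≡ sA → u ∉ Y → PathAvoid Y u u
      step : ∀ {u w v} → u ∉ Y → Arc u w → PathAvoid Y w v → PathAvoid Y u v

    -- Y is an S,T-separator in H (Y ⊆ V(H) = A)
    Separator : (Fin n → Set) → Subset n → Subset n → Set
    Separator S T Y =
      (∀ v → v ∈ Y → side v ≡ sA)
      × (∀ s t → S s → s ∉ Y → t ∈ T → t ∉ Y → ¬ PathAvoid Y s t)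

    Closest : (Fin n → Set) → Subset n → Set
    Closest S T = ∀ Y → Separator S T Y → ∣ Y ∣ ≤ ∣ T ∣ → Y ≡ T

  VertexCover : Subset n → Set
  VertexCover X = ∀ u v → Adj G u v → u ∈ X ⊎ v ∈ X

  Dominant : Subset n → Set
  Dominant X = VertexCover X
             × (∀ X' → VertexCover X' → ∣ X ∣ ≤ ∣ X' ∣)
             × (∀ X' → VertexCover X' → ∣ X' ∣ ≡ ∣ X ∣ → ∣ X ∩ DSet ∣ ≤ ∣ X' ∩ DSet ∣)

-- Let Y be an A₃,Xop-separator of H with ∣ Y ∣ ≤ ∣ Xop ∣, and let R be the set of vertices
-- from which Xop ─ Y can be reached in H − Y. No vertex of R is in A₃, so every v ∈ R is
-- matched to a singleton component σ v of G[D]. Deleting σ[R] from X and adding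
-- (Y ─ Xop) ∪ (R ─ X) gives again a vertex cover X′: a neighbour u ≠ v of σ v has the arc
-- u → v in H, so u lies in Y or in R. The mate map σ sends (R ─ X) ∪ (Xop ─ Y) injectively
-- into X ∩ σ[R], hence ∣ X′ ∣ ≤ ∣ X ∣. Dominance of X now says X′ has no fewer vertices
-- of D, which forces X ∩ σ[R] = ∅; so Xop ⊆ Y, and Y = Xop by cardinality.
module Submission where

open import Defs hiding (sym)
open import Data.Bool using (Bool; true; if_then_else_)
open import Data.Bool.Properties using () renaming (_≟_ to _≟ᵇ_)
open import Data.Empty using (⊥-elim)
open import Data.Fin using (Fin) renaming (_≟_ to _≟ᶠ_)
open import Data.Fin.Permutation using (permutation)
open import Data.Fin.Properties using (any?)
open import Data.Fin.Subset
  using (Subset; inside; outside; _∈_; _∉_; _⊆_; ∣_∣; _∩_; _∪_; _─_)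
open import Data.Fin.Subset.Properties
  using (_∈?_; drop-∷-⊆; ∣p∣≤n; ∣p∣≤∣x∷p∣; p⊆q⇒∣p∣≤∣q∣; p⊆p∪q;
         x∈p∪q⁺; x∈p∪q⁻; x∈p∩q⁺; x∈p∩q⁻; ∩-comm; p─q⊆p; x∈p∧x∉q⇒x∈p─q;
         x∈p⇒∣p-x∣<∣p∣)
open import Data.Maybe using (just; nothing; fromMaybe)
open import Data.Maybe.Properties using (just-injective) renaming (≡-dec to ≡-decᵐ)
open import Data.Nat using (ℕ; zero; suc; _+_; _≤_; _<_; z≤n; s≤s)
open import Data.Nat.GeneralisedArithmetic using (iterate)
open import Data.Nat.Properties
open import Algebra.Properties.CommutativeMonoid.Sum +-0-commutativeMonoid
  using (sum; sum-cong-≗; ∑-permute)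
open import Data.Product using (∃-syntax; _×_; _,_; proj₁; proj₂)
open import Data.Sum using (_⊎_; inj₁; inj₂; swap)
open import Data.Vec using (_∷_; []; lookup; tabulate; here; there)
open import Data.Vec.Properties using (lookup∘tabulate; []=⇒lookup; lookup⇒[]=)
  renaming (≡-dec to ≡-decᵛ)
open import Function using (_∘_; id)
open import Function.Bundles using (_⇔_; Equivalence)
open import Relation.Binary.Definitions using (DecidableEquality)
open import Relation.Binary.PropositionalEquality
open import Relation.Nullary using (Dec; yes; no; does; ¬_; ¬?; contradiction)
open import Relation.Nullary.Decidable using (_×-dec_; dec-true)
open import Relation.Unary using (Pred; Decidable)

x∈tabulate⁺ : ∀ {n} {f : Fin n → Bool} {x} → f x ≡ true → x ∈ tabulate f
x∈tabulate⁺ {f = f} {x} fx = lookup⇒[]= x (tabulate f) (trans (lookup∘tabulate f x) fx)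

x∈tabulate⁻ : ∀ {n} {f : Fin n → Bool} {x} → x ∈ tabulate f → f x ≡ true
x∈tabulate⁻ {f = f} {x} x∈ = trans (sym (lookup∘tabulate f x)) ([]=⇒lookup x∈)

⟦_⟧ : ∀ {n ℓ} {P : Pred (Fin n) ℓ} → Decidable P → Subset n
⟦ P? ⟧ = tabulate (does ∘ P?)

∈⟦⟧⁺ : ∀ {n ℓ} {P : Pred (Fin n) ℓ} (P? : Decidable P) {x} → P x → x ∈ ⟦ P? ⟧
∈⟦⟧⁺ P? {x} px = x∈tabulate⁺ (dec-true (P? x) px)

∈⟦⟧⁻ : ∀ {n ℓ} {P : Pred (Fin n) ℓ} (P? : Decidable P) {x} → x ∈ ⟦ P? ⟧ → P x
∈⟦⟧⁻ P? {x} x∈ with P? x | x∈tabulate⁻ {f = does ∘ P?} x∈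
... | yes px | _ = px
... | no _   | ()

x∈p─q⇒x∉q : ∀ {n} {p q : Subset n} {x} → x ∈ p ─ q → x ∉ q
x∈p─q⇒x∉q {p = inside ∷ p}  {outside ∷ q} here       ()
x∈p─q⇒x∉q {p = _ ∷ p}       {_ ∷ q}       (there x∈) (there x∈q) = x∈p─q⇒x∉q {p = p} x∈ x∈q

∣p∪q∣≤∣p∣+∣q∣ : ∀ {n} (p q : Subset n) → ∣ p ∪ q ∣ ≤ ∣ p ∣ + ∣ q ∣
∣p∪q∣≤∣p∣+∣q∣ []            []            = z≤n
∣p∪q∣≤∣p∣+∣q∣ (inside  ∷ p) (s ∷ q)       =
  s≤s (≤-trans (∣p∪q∣≤∣p∣+∣q∣ p q) (+-monoʳ-≤ ∣ p ∣ (∣p∣≤∣x∷p∣ s q)))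
∣p∪q∣≤∣p∣+∣q∣ (outside ∷ p) (inside  ∷ q) =
  ≤-trans (s≤s (∣p∪q∣≤∣p∣+∣q∣ p q)) (≤-reflexive (sym (+-suc ∣ p ∣ ∣ q ∣)))
∣p∪q∣≤∣p∣+∣q∣ (outside ∷ p) (outside ∷ q) = ∣p∪q∣≤∣p∣+∣q∣ p q

∣p∪q∣≡∣p∣+∣q∣ : ∀ {n} (p q : Subset n) → (∀ {x} → x ∈ p → x ∉ q) →
                ∣ p ∪ q ∣ ≡ ∣ p ∣ + ∣ q ∣
∣p∪q∣≡∣p∣+∣q∣ []            []            _        = refl
∣p∪q∣≡∣p∣+∣q∣ (inside  ∷ p) (inside  ∷ q) disjoint = contradiction here (disjoint here)
∣p∪q∣≡∣p∣+∣q∣ (inside  ∷ p) (outside ∷ q) disjoint =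
  cong suc (∣p∪q∣≡∣p∣+∣q∣ p q λ x∈p x∈q → disjoint (there x∈p) (there x∈q))
∣p∪q∣≡∣p∣+∣q∣ (outside ∷ p) (inside  ∷ q) disjoint =
  trans (cong suc (∣p∪q∣≡∣p∣+∣q∣ p q λ x∈p x∈q → disjoint (there x∈p) (there x∈q)))
        (sym (+-suc ∣ p ∣ ∣ q ∣))
∣p∪q∣≡∣p∣+∣q∣ (outside ∷ p) (outside ∷ q) disjoint =
  ∣p∪q∣≡∣p∣+∣q∣ p q λ x∈p x∈q → disjoint (there x∈p) (there x∈q)

∣p∩q∣+∣p─q∣≡∣p∣ : ∀ {n} (p q : Subset n) → ∣ p ∩ q ∣ + ∣ p ─ q ∣ ≡ ∣ p ∣
∣p∩q∣+∣p─q∣≡∣p∣ []            []            = refl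
∣p∩q∣+∣p─q∣≡∣p∣ (inside  ∷ p) (inside  ∷ q) = cong suc (∣p∩q∣+∣p─q∣≡∣p∣ p q)
∣p∩q∣+∣p─q∣≡∣p∣ (inside  ∷ p) (outside ∷ q) =
  trans (+-suc ∣ p ∩ q ∣ ∣ p ─ q ∣) (cong suc (∣p∩q∣+∣p─q∣≡∣p∣ p q))
∣p∩q∣+∣p─q∣≡∣p∣ (outside ∷ p) (inside  ∷ q) = ∣p∩q∣+∣p─q∣≡∣p∣ p q
∣p∩q∣+∣p─q∣≡∣p∣ (outside ∷ p) (outside ∷ q) = ∣p∩q∣+∣p─q∣≡∣p∣ p q

∣p∣≤∣q∣⇒∣p─q∣≤∣q─p∣ : ∀ {n} (p q : Subset n) → ∣ p ∣ ≤ ∣ q ∣ → ∣ p ─ q ∣ ≤ ∣ q ─ p ∣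
∣p∣≤∣q∣⇒∣p─q∣≤∣q─p∣ p q ∣p∣≤∣q∣ = +-cancelˡ-≤ ∣ p ∩ q ∣ _ _ (begin
  ∣ p ∩ q ∣ + ∣ p ─ q ∣ ≡⟨ ∣p∩q∣+∣p─q∣≡∣p∣ p q ⟩
  ∣ p ∣                 ≤⟨ ∣p∣≤∣q∣ ⟩
  ∣ q ∣                 ≡⟨ ∣p∩q∣+∣p─q∣≡∣p∣ q p ⟨
  ∣ q ∩ p ∣ + ∣ q ─ p ∣ ≡⟨ cong (λ r → ∣ r ∣ + ∣ q ─ p ∣) (∩-comm q p) ⟩
  ∣ p ∩ q ∣ + ∣ q ─ p ∣ ∎)
  where open ≤-Reasoning

p⊆q∧∣q∣≤∣p∣⇒p≡q : ∀ {n} {p q : Subset n} → p ⊆ q → ∣ q ∣ ≤ ∣ p ∣ → p ≡ q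
p⊆q∧∣q∣≤∣p∣⇒p≡q {p = []}          {[]}          _   _  = refl
p⊆q∧∣q∣≤∣p∣⇒p≡q {p = inside  ∷ p} {inside  ∷ q} p⊆q le =
  cong (inside ∷_) (p⊆q∧∣q∣≤∣p∣⇒p≡q (drop-∷-⊆ p⊆q) (≤-pred le))
p⊆q∧∣q∣≤∣p∣⇒p≡q {p = inside  ∷ p} {outside ∷ q} p⊆q _  = contradiction (p⊆q here) λ ()
p⊆q∧∣q∣≤∣p∣⇒p≡q {p = outside ∷ p} {inside  ∷ q} p⊆q le =
  contradiction (≤-trans le (p⊆q⇒∣p∣≤∣q∣ (drop-∷-⊆ p⊆q))) (<-irrefl refl)
p⊆q∧∣q∣≤∣p∣⇒p≡q {p = outside ∷ p} {outside ∷ q} p⊆q le =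
  cong (outside ∷_) (p⊆q∧∣q∣≤∣p∣⇒p≡q (drop-∷-⊆ p⊆q) le)

indicator : Bool → ℕ
indicator b = if b then 1 else 0

∣p∣≡∑ : ∀ {n} (p : Subset n) → ∣ p ∣ ≡ sum (indicator ∘ lookup p)
∣p∣≡∑ []            = refl
∣p∣≡∑ (inside  ∷ p) = cong suc (∣p∣≡∑ p)
∣p∣≡∑ (outside ∷ p) = ∣p∣≡∑ p

preimage : ∀ {n} → (Fin n → Fin n) → Subset n → Subset n
preimage σ p = tabulate (lookup p ∘ σ)

x∈preimage⁺ : ∀ {n} {σ : Fin n → Fin n} {p x} → σ x ∈ p → x ∈ preimage σ p
x∈preimage⁺ σx∈p = x∈tabulate⁺ ([]=⇒lookup σx∈p)

x∈preimage⁻ : ∀ {n} {σ : Fin n → Fin n} {p x} → x ∈ preimage σ p → σ x ∈ p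
x∈preimage⁻ {σ = σ} {p} {x} x∈ = lookup⇒[]= (σ x) p (x∈tabulate⁻ x∈)

∣preimage∣ : ∀ {n} (σ : Fin n → Fin n) → (∀ x → σ (σ x) ≡ x) →
             ∀ p → ∣ preimage σ p ∣ ≡ ∣ p ∣
∣preimage∣ σ σσ p = begin
  ∣ preimage σ p ∣                         ≡⟨ ∣p∣≡∑ (preimage σ p) ⟩
  sum (indicator ∘ lookup (preimage σ p))  ≡⟨ sum-cong-≗ (cong indicator ∘ lookup∘tabulate (lookup p ∘ σ)) ⟩
  sum (indicator ∘ lookup p ∘ σ)           ≡⟨ ∑-permute (indicator ∘ lookup p) (permutation σ σ σσ σσ) ⟨
  sum (indicator ∘ lookup p)               ≡⟨ ∣p∣≡∑ p ⟨
  ∣ p ∣                                    ∎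
  where open ≡-Reasoning

∣p∣≤∣q∣-via-involution : ∀ {n} (σ : Fin n → Fin n) → (∀ x → σ (σ x) ≡ x) →
                         ∀ {p q} → (∀ {x} → x ∈ p → σ x ∈ q) → ∣ p ∣ ≤ ∣ q ∣
∣p∣≤∣q∣-via-involution σ σσ {p} {q} σ[p]⊆q =
  ≤-trans (p⊆q⇒∣p∣≤∣q∣ (x∈preimage⁺ ∘ σ[p]⊆q)) (≤-reflexive (∣preimage∣ σ σσ q))

module _ {n} (f : Subset n → Subset n) (inflationary : ∀ p → p ⊆ f p) where

  iterate-fixed : ∀ {p} → f p ≡ p → ∀ k → iterate f p k ≡ p
  iterate-fixed fp≡p zero    = refl
  iterate-fixed fp≡p (suc k) rewrite fp≡p = iterate-fixed fp≡p k

  ∣p∣<∣fp∣ : ∀ {p} → f p ≢ p → ∣ p ∣ < ∣ f p ∣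
  ∣p∣<∣fp∣ fp≢p = ≰⇒> λ ∣fp∣≤∣p∣ → fp≢p (sym (p⊆q∧∣q∣≤∣p∣⇒p≡q (inflationary _) ∣fp∣≤∣p∣))

  -- Every step that is not yet stable adds an element, and only n − ∣ p ∣ can be added.
  iterate-stable : ∀ k p → n ≤ k + ∣ p ∣ → f (iterate f p k) ≡ iterate f p k
  iterate-stable k p bound with ≡-decᵛ _≟ᵇ_ (f p) p
  ... | yes fp≡p = subst (λ q → f q ≡ q) (sym (iterate-fixed fp≡p k)) fp≡p
  iterate-stable zero    p bound | no fp≢p =
    contradiction (≤-trans (∣p∣≤n (f p)) bound) (<⇒≱ (∣p∣<∣fp∣ fp≢p))
  iterate-stable (suc k) p bound | no fp≢p = iterate-stable k (f p) (begin
    n              ≤⟨ bound ⟩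
    suc k + ∣ p ∣  ≡⟨ +-suc k ∣ p ∣ ⟨
    k + suc ∣ p ∣  ≤⟨ +-monoʳ-≤ k (∣p∣<∣fp∣ fp≢p) ⟩
    k + ∣ f p ∣    ∎)
    where open ≤-Reasoning

  ⊆-iterate : ∀ p k → p ⊆ iterate f p k
  ⊆-iterate p zero    = id
  ⊆-iterate p (suc k) = ⊆-iterate (f p) k ∘ inflationary p

  iterate-preserves : ∀ {ℓ} (I : Pred (Fin n) ℓ) →
                      (∀ {q} → (∀ {x} → x ∈ q → I x) → ∀ {x} → x ∈ f q → I x) →
                      ∀ {p} k → (∀ {x} → x ∈ p → I x) → ∀ {x} → x ∈ iterate f p k → I x
  iterate-preserves I preserves zero    p⊆I = p⊆I
  iterate-preserves I preserves (suc k) p⊆I = iterate-preserves I preserves k (preserves p⊆I)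

_≟ˢ_ : DecidableEquality Side
sA ≟ˢ sA = yes refl
sA ≟ˢ sB = no λ ()
sA ≟ˢ sD = no λ ()
sB ≟ˢ sA = no λ ()
sB ≟ˢ sB = yes refl
sB ≟ˢ sD = no λ ()
sD ≟ˢ sA = no λ ()
sD ≟ˢ sB = no λ ()
sD ≟ˢ sD = yes refl

module _ {n} {G : Graph n} {side : Fin n → Side} {M : Matching G} {Y : Subset n} where

  PathAvoid-source∉ : ∀ {u t} → PathAvoid G side M Y u t → u ∉ Y
  PathAvoid-source∉ (here _ u∉Y)   = u∉Y
  PathAvoid-source∉ (step u∉Y _ _) = u∉Y

  PathAvoid-sourceA : ∀ {u t} → PathAvoid G side M Y u t → side u ≡ sA
  PathAvoid-sourceA (here u∈A _)   = u∈A
  PathAvoid-sourceA (step _ arc _) = proj₁ arc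

≡sA⇒≢sD : ∀ {s} → s ≡ sA → s ≢ sD
≡sA⇒≢sD refl ()

module _ {n} (G : Graph n) (side : Fin n → Side) where

  x∈DSet⁻ : ∀ {x} → x ∈ DSet G side → side x ≡ sD
  x∈DSet⁻ {x} x∈D with side x | x∈tabulate⁻ {f = isD ∘ side} x∈D
  ... | sD | _ = refl

  x∈DSet⁺ : ∀ {x} → side x ≡ sD → x ∈ DSet G side
  x∈DSet⁺ x∈D = x∈tabulate⁺ (cong isD x∈D)

  Arc? : (M : Matching G) → ∀ u v → Dec (Arc G side M u v)
  Arc? M u v = side u ≟ˢ sA ×-dec side v ≟ˢ sA ×-dec any? λ w →
    side w ≟ˢ sD ×-dec adj? G u w ×-dec ¬? (≡-decᵐ _≟ᶠ_ (mate M u) (just w))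
                 ×-dec ≡-decᵐ _≟ᶠ_ (mate M w) (just v)

module _ {n} {G : Graph n} (M : Matching G) where

  σ : Fin n → Fin n
  σ v = fromMaybe v (mate M v)

  σ-mate : ∀ {v w} → mate M v ≡ just w → σ v ≡ w
  σ-mate v↦w rewrite v↦w = refl

  σ-involutive : ∀ v → σ (σ v) ≡ v
  σ-involutive v with mate M v in v↦
  ... | nothing rewrite v↦ = refl
  ... | just w  rewrite mate-sym M v↦ = refl

module ClosestToA₃ {n} (G : Graph n) (side : Fin n → Side) (M : Matching G)
  (ged : IsRelaxedGED G side M) (X : Subset n) (dom : Dominant G side X)
  (Xop : Subset n) (xop : ∀ v → (v ∈ Xop) ⇔ InXop G side M X v)
  (Y : Subset n) (separates : Separator G side M (A₃ G side M) Xop Y)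
  (∣Y∣≤∣Xop∣ : ∣ Y ∣ ≤ ∣ Xop ∣) where

  open IsRelaxedGED ged using (ND⇒A; matchA)

  D = DSet G side

  Xop⊆X : Xop ⊆ X
  Xop⊆X {v} v∈Xop with Equivalence.to (xop v) v∈Xop
  ... | inj₁ (_ , v∈X , _) = v∈X
  ... | inj₂ (_ , v∈X)     = v∈X

  Xop⊆A : ∀ {v} → v ∈ Xop → side v ≡ sA
  Xop⊆A {v} v∈Xop with Equivalence.to (xop v) v∈Xop
  ... | inj₁ ((v∈A , _) , _) = v∈A
  ... | inj₂ ((v∈A , _) , _) = v∈A

  predecessor? : ∀ p → Decidable λ v → v ∉ Y × ∃[ w ] (Arc G side M v w × w ∈ p)
  predecessor? p v = ¬? (v ∈? Y) ×-dec any? λ w → Arc? G side M v w ×-dec w ∈? p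

  extend : Subset n → Subset n
  extend p = p ∪ ⟦ predecessor? p ⟧

  R : Subset n
  R = iterate extend (Xop ─ Y) n

  extend-inflationary : ∀ p → p ⊆ extend p
  extend-inflationary p = p⊆p∪q _

  R-closed : ∀ {v w} → v ∉ Y → Arc G side M v w → w ∈ R → v ∈ R
  R-closed v∉Y arc w∈R =
    subst (_ ∈_) (iterate-stable extend extend-inflationary n (Xop ─ Y) (m≤m+n n _))
          (x∈p∪q⁺ (inj₂ (∈⟦⟧⁺ (predecessor? R) (v∉Y , _ , arc , w∈R))))

  Xop─Y⊆R : Xop ─ Y ⊆ R
  Xop─Y⊆R = ⊆-iterate extend extend-inflationary (Xop ─ Y) n

  Reaches : Fin n → Set
  Reaches v = ∃[ t ] (t ∈ Xop × t ∉ Y × PathAvoid G side M Y v t)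

  R-reaches : ∀ {v} → v ∈ R → Reaches v
  R-reaches = iterate-preserves extend extend-inflationary Reaches preserves n start
    where
    start : ∀ {v} → v ∈ Xop ─ Y → Reaches v
    start {v} v∈ = v , v∈Xop , v∉Y , here (Xop⊆A v∈Xop) v∉Y
      where
      v∈Xop = p─q⊆p Xop Y v∈
      v∉Y = x∈p─q⇒x∉q {p = Xop} v∈
    preserves : ∀ {q} → (∀ {x} → x ∈ q → Reaches x) → ∀ {x} → x ∈ extend q → Reaches x
    preserves {q} q⊆I x∈ with x∈p∪q⁻ q _ x∈
    ... | inj₁ x∈q = q⊆I x∈q
    ... | inj₂ x∈new with ∈⟦⟧⁻ (predecessor? q) x∈new
    ...   | x∉Y , w , arc , w∈q with q⊆I w∈q
    ...     | t , t∈Xop , t∉Y , path = t , t∈Xop , t∉Y , step x∉Y arc path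

  R⊆A : ∀ {v} → v ∈ R → side v ≡ sA
  R⊆A = PathAvoid-sourceA ∘ proj₂ ∘ proj₂ ∘ proj₂ ∘ R-reaches

  R∉A₃ : ∀ {v} → v ∈ R → ¬ A₃ G side M v
  R∉A₃ {v} v∈R v∈A₃ with R-reaches v∈R
  ... | t , t∈Xop , t∉Y , path =
    proj₂ separates v t v∈A₃ (PathAvoid-source∉ path) t∈Xop t∉Y path

  R-matched : ∀ {v} → v ∈ R → mate M v ≡ just (σ M v) × Singleton G side (σ M v)
  R-matched {v} v∈R with matchA v (R⊆A v∈R)
  ... | d , v↦d , d∈D =
    subst (λ w → mate M v ≡ just w × Singleton G side w) (sym (σ-mate M v↦d))
          (v↦d , d∈D , component)
    where
    component : ∀ x → ConnD G side d x → x ≡ d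
    component x d~x with x ≟ᶠ d
    ... | yes x≡d = x≡d
    ... | no  x≢d = ⊥-elim (R∉A₃ v∈R (R⊆A v∈R , d , v↦d , d∈D , x , d~x , x≢d))

  Pre : Subset n
  Pre = preimage (σ M) R

  σ[R]⊆Pre : ∀ {v} → v ∈ R → σ M v ∈ Pre
  σ[R]⊆Pre {v} v∈R = x∈preimage⁺ (subst (_∈ R) (sym (σ-involutive M v)) v∈R)

  Pre-matched : ∀ {u} → u ∈ Pre → mate M u ≡ just (σ M u) × Singleton G side u
  Pre-matched {u} u∈Pre with R-matched (x∈preimage⁻ u∈Pre)
  ... | σu↦σσu , singleton rewrite σ-involutive M u =
    mate-sym M σu↦σσu , singleton

  Pre⊆D : ∀ {u} → u ∈ Pre → side u ≡ sD
  Pre⊆D = proj₁ ∘ proj₂ ∘ Pre-matched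

  Pre-neighbour∈A : ∀ {u v} → u ∈ Pre → Adj G u v → side v ≡ sA
  Pre-neighbour∈A {u} {v} u∈Pre uv with side v ≟ˢ sD
  ... | no  v∉D = ND⇒A v u v∉D (Pre⊆D u∈Pre) (Graph.sym G uv)
  ... | yes v∈D = contradiction (subst (Adj G u) v≡u uv) (irrefl G)
    where
    v≡u = proj₂ (proj₂ (Pre-matched u∈Pre)) v (step (Pre⊆D u∈Pre) uv (here v∈D))

  Pre-neighbour-arc : ∀ {u v} → u ∈ Pre → Adj G u v → v ≢ σ M u → Arc G side M v (σ M u)
  Pre-neighbour-arc {u} {v} u∈Pre uv v≢σu =
    Pre-neighbour∈A u∈Pre uv , R⊆A (x∈preimage⁻ u∈Pre) , u , Pre⊆D u∈Pre ,
    Graph.sym G uv , v↦̸u , u↦σu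
    where
    u↦σu = proj₁ (Pre-matched u∈Pre)
    v↦̸u : mate M v ≢ just u
    v↦̸u v↦u = v≢σu (just-injective (trans (sym (mate-sym M v↦u)) u↦σu))

  X′ : Subset n
  X′ = (X ─ Pre) ∪ ((Y ─ Xop) ∪ (R ─ X))

  Pre-neighbour∈X′ : ∀ {u v} → u ∈ Pre → Adj G u v → v ∈ X′
  Pre-neighbour∈X′ {u} {v} u∈Pre uv with v ∈? X
  ... | yes v∈X = x∈p∪q⁺ (inj₁ (x∈p∧x∉q⇒x∈p─q v∈X (≡sA⇒≢sD (Pre-neighbour∈A u∈Pre uv) ∘ Pre⊆D)))
  ... | no v∉X with v ∈? Y
  ...   | yes v∈Y = x∈p∪q⁺ (inj₂ (x∈p∪q⁺ (inj₁ (x∈p∧x∉q⇒x∈p─q v∈Y (v∉X ∘ Xop⊆X)))))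
  ...   | no  v∉Y = x∈p∪q⁺ (inj₂ (x∈p∪q⁺ (inj₂ (x∈p∧x∉q⇒x∈p─q v∈R v∉X))))
    where
    σu∈R = x∈preimage⁻ u∈Pre
    v∈R : v ∈ R
    v∈R with v ≟ᶠ σ M u
    ... | yes v≡σu = subst (_∈ R) (sym v≡σu) σu∈R
    ... | no  v≢σu = R-closed v∉Y (Pre-neighbour-arc u∈Pre uv v≢σu) σu∈R

  X′-covers-from : ∀ {u v} → Adj G u v → u ∈ X → u ∈ X′ ⊎ v ∈ X′
  X′-covers-from {u} uv u∈X with u ∈? Pre
  ... | no  u∉Pre = inj₁ (x∈p∪q⁺ (inj₁ (x∈p∧x∉q⇒x∈p─q u∈X u∉Pre)))
  ... | yes u∈Pre = inj₂ (Pre-neighbour∈X′ u∈Pre uv)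

  X′-cover : VertexCover G side X′
  X′-cover u v uv with proj₁ dom u v uv
  ... | inj₁ u∈X = X′-covers-from uv u∈X
  ... | inj₂ v∈X = swap (X′-covers-from (Graph.sym G uv) v∈X)

  σ[R─X]⊆X : ∀ {v} → v ∈ R → v ∉ X → σ M v ∈ X
  σ[R─X]⊆X {v} v∈R v∉X with proj₁ dom v (σ M v) (mate-adj M (proj₁ (R-matched v∈R)))
  ... | inj₁ v∈X  = contradiction v∈X v∉X
  ... | inj₂ σv∈X = σv∈X

  σ[R∩Xop]⊆X : ∀ {v} → v ∈ R → v ∈ Xop → σ M v ∈ X
  σ[R∩Xop]⊆X {v} v∈R v∈Xop with Equivalence.to (xop v) v∈Xop
  ... | inj₁ (_ , _ , w , v↦w , w∈X) = subst (_∈ X) (sym (σ-mate M v↦w)) w∈X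
  ... | inj₂ (v∈A₃ , _)             = contradiction v∈A₃ (R∉A₃ v∈R)

  ∣R─X∣+∣Xop─Y∣≤∣X∩Pre∣ : ∣ R ─ X ∣ + ∣ Xop ─ Y ∣ ≤ ∣ X ∩ Pre ∣
  ∣R─X∣+∣Xop─Y∣≤∣X∩Pre∣ = begin
    ∣ R ─ X ∣ + ∣ Xop ─ Y ∣     ≡⟨ ∣p∪q∣≡∣p∣+∣q∣ (R ─ X) (Xop ─ Y) disjoint ⟨
    ∣ (R ─ X) ∪ (Xop ─ Y) ∣     ≤⟨ ∣p∣≤∣q∣-via-involution (σ M) (σ-involutive M) σ-into ⟩
    ∣ X ∩ Pre ∣                 ∎
    where
    open ≤-Reasoning
    disjoint : ∀ {v} → v ∈ R ─ X → v ∉ Xop ─ Y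
    disjoint v∈R─X = x∈p─q⇒x∉q {p = R} v∈R─X ∘ Xop⊆X ∘ p─q⊆p Xop Y
    σ-into : ∀ {v} → v ∈ (R ─ X) ∪ (Xop ─ Y) → σ M v ∈ X ∩ Pre
    σ-into v∈ with x∈p∪q⁻ (R ─ X) (Xop ─ Y) v∈
    ... | inj₁ v∈R─X = x∈p∩q⁺ (σ[R─X]⊆X v∈R (x∈p─q⇒x∉q {p = R} v∈R─X) , σ[R]⊆Pre v∈R)
      where v∈R = p─q⊆p R X v∈R─X
    ... | inj₂ v∈Xop─Y = x∈p∩q⁺ (σ[R∩Xop]⊆X v∈R (p─q⊆p Xop Y v∈Xop─Y) , σ[R]⊆Pre v∈R)
      where v∈R = Xop─Y⊆R v∈Xop─Y

  ∣X′∣≤∣X∣ : ∣ X′ ∣ ≤ ∣ X ∣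
  ∣X′∣≤∣X∣ = begin
    ∣ X′ ∣                                           ≤⟨ ∣p∪q∣≤∣p∣+∣q∣ (X ─ Pre) _ ⟩
    ∣ X ─ Pre ∣ + ∣ (Y ─ Xop) ∪ (R ─ X) ∣            ≤⟨ +-monoʳ-≤ ∣ X ─ Pre ∣ (∣p∪q∣≤∣p∣+∣q∣ (Y ─ Xop) _) ⟩
    ∣ X ─ Pre ∣ + (∣ Y ─ Xop ∣ + ∣ R ─ X ∣)          ≤⟨ +-monoʳ-≤ ∣ X ─ Pre ∣ (+-monoˡ-≤ ∣ R ─ X ∣ (∣p∣≤∣q∣⇒∣p─q∣≤∣q─p∣ Y Xop ∣Y∣≤∣Xop∣)) ⟩
    ∣ X ─ Pre ∣ + (∣ Xop ─ Y ∣ + ∣ R ─ X ∣)          ≡⟨ cong (∣ X ─ Pre ∣ +_) (+-comm ∣ Xop ─ Y ∣ ∣ R ─ X ∣) ⟩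
    ∣ X ─ Pre ∣ + (∣ R ─ X ∣ + ∣ Xop ─ Y ∣)          ≤⟨ +-monoʳ-≤ ∣ X ─ Pre ∣ ∣R─X∣+∣Xop─Y∣≤∣X∩Pre∣ ⟩
    ∣ X ─ Pre ∣ + ∣ X ∩ Pre ∣                        ≡⟨ +-comm ∣ X ─ Pre ∣ ∣ X ∩ Pre ∣ ⟩
    ∣ X ∩ Pre ∣ + ∣ X ─ Pre ∣                        ≡⟨ ∣p∩q∣+∣p─q∣≡∣p∣ X Pre ⟩
    ∣ X ∣                                            ∎
    where open ≤-Reasoning

  X′∩D⊆X∩D─Pre : X′ ∩ D ⊆ (X ∩ D) ─ Pre
  X′∩D⊆X∩D─Pre {v} v∈ with x∈p∩q⁻ X′ D v∈
  ... | v∈X′ , v∈D with x∈p∪q⁻ (X ─ Pre) _ v∈X′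
  ...   | inj₁ v∈X─Pre =
    x∈p∧x∉q⇒x∈p─q (x∈p∩q⁺ (p─q⊆p X Pre v∈X─Pre , v∈D)) (x∈p─q⇒x∉q {p = X} v∈X─Pre)
  ...   | inj₂ v∈Y─Xop∪R─X = ⊥-elim (≡sA⇒≢sD (Y─Xop∪R─X⊆A v∈Y─Xop∪R─X) (x∈DSet⁻ G side v∈D))
    where
    Y─Xop∪R─X⊆A : ∀ {v} → v ∈ (Y ─ Xop) ∪ (R ─ X) → side v ≡ sA
    Y─Xop∪R─X⊆A v∈ with x∈p∪q⁻ (Y ─ Xop) _ v∈
    ... | inj₁ v∈Y─Xop = proj₁ separates _ (p─q⊆p Y Xop v∈Y─Xop)
    ... | inj₂ v∈R─X   = R⊆A (p─q⊆p R X v∈R─X)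

  ∣X∩Pre∣≡0 : ∣ X ∩ Pre ∣ ≡ 0
  ∣X∩Pre∣≡0 = n≤0⇒n≡0 (≤-trans (p⊆q⇒∣p∣≤∣q∣ X∩Pre⊆X∩D∩Pre) (+-cancelʳ-≤ _ _ 0 (begin
    ∣ (X ∩ D) ∩ Pre ∣ + ∣ (X ∩ D) ─ Pre ∣ ≡⟨ ∣p∩q∣+∣p─q∣≡∣p∣ (X ∩ D) Pre ⟩
    ∣ X ∩ D ∣                           ≤⟨ proj₂ (proj₂ dom) X′ X′-cover ∣X′∣≡∣X∣ ⟩
    ∣ X′ ∩ D ∣                          ≤⟨ p⊆q⇒∣p∣≤∣q∣ X′∩D⊆X∩D─Pre ⟩
    ∣ (X ∩ D) ─ Pre ∣                   ∎)))
    where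
    open ≤-Reasoning
    ∣X′∣≡∣X∣ = ≤-antisym ∣X′∣≤∣X∣ (proj₁ (proj₂ dom) X′ X′-cover)
    X∩Pre⊆X∩D∩Pre : X ∩ Pre ⊆ (X ∩ D) ∩ Pre
    X∩Pre⊆X∩D∩Pre v∈ with x∈p∩q⁻ X Pre v∈
    ... | v∈X , v∈Pre = x∈p∩q⁺ (x∈p∩q⁺ (v∈X , x∈DSet⁺ G side (Pre⊆D v∈Pre)) , v∈Pre)

  Xop⊆Y : Xop ⊆ Y
  Xop⊆Y {v} v∈Xop with v ∈? Y
  ... | yes v∈Y = v∈Y
  ... | no  v∉Y = contradiction (≤-trans (x∈p⇒∣p-x∣<∣p∣ v∈Xop─Y) ∣Xop─Y∣≤0) λ ()
    where
    v∈Xop─Y = x∈p∧x∉q⇒x∈p─q v∈Xop v∉Y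
    ∣Xop─Y∣≤0 : ∣ Xop ─ Y ∣ ≤ 0
    ∣Xop─Y∣≤0 = ≤-trans (m≤n+m _ _) (≤-trans ∣R─X∣+∣Xop─Y∣≤∣X∩Pre∣ (≤-reflexive ∣X∩Pre∣≡0))

  Y≡Xop : Y ≡ Xop
  Y≡Xop = sym (p⊆q∧∣q∣≤∣p∣⇒p≡q Xop⊆Y ∣Y∣≤∣Xop∣)

lemma22 : ∀ {n : ℕ} (G : Graph n) (side : Fin n → Side) (M : Matching G)
          → IsRelaxedGED G side M → Nice G side M
          → (X : Subset n) → Dominant G side X
          → (Xop : Subset n) → (∀ v → (v ∈ Xop) ⇔ InXop G side M X v)
          → Closest G side M (A₃ G side M) Xop
lemma22 G side M ged _ X dom Xop xop Y separates ∣Y∣≤∣Xop∣ =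
  ClosestToA₃.Y≡Xop G side M ged X dom Xop xop Y separates ∣Y∣≤∣Xop∣
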